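{- For every positive integer $n$, the number of lattice rectangles contained in half of an Aztec diamond of order $n$ (i.e. in the region $H_n$ defined below) is \[ a_{\frac12}(n)=3\binom{n+3}{4}+\binom{n+2}{4}=\frac{n(n+1)(n+2)^{2}}{6}. \]
   Context: A lattice rectangle is a set $[x,x']\times[y,y']\subseteq\mathbb{R}^2$ with $x<x'$, $y<y'$ and $x,x',y,y'\in\mathbb{Z}$ (squares included). A unit lattice square is a lattice rectangle with all sides of length $1$. For a positive integer $n$, the Aztec diamond of order $n$ is the union of the unit lattice squares $[i,i+1]\times[j,j+1]$ ($i,j\in\mathbb{Z}$) with $|i+\tfrac12|+|j+\tfrac12|\le n$. Half of it (obtained by cutting it through its center with a horizontal line) is the region $H_n$, the union of the unit lattice squares $[i,i+1]\times[j,j+1]$ with $0\le j\le n-1$ and $-(n-j)\le i\le n-j-1$; equivalently, $n$ stacked rows of consecutive unit lattice squares with row centers vertically aligned, of lengths $2n,2n-2,\ldots,4,2$ from bottom to top. The count is of lattice rectangles that are subsets of this region. Binomial coefficients $\binom{m}{4}$ are $0$ when $m<4$. -}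

module Defs where

open import Data.Bool using (Bool; true; false; _∧_)
open import Data.Nat using (ℕ; zero; suc)
open import Data.Integer using (ℤ; +_; -_; _+_; _-_; ∣_∣; _≤?_; _<?_)
open import Data.List using (List; []; _∷_)
open import Data.Product using (_×_; _,_)
open import Relation.Nullary.Decidable using (⌊_⌋)

-- The unit lattice square [i,i+1]×[j,j+1] belongs to H_n iff
--   0 ≤ j ≤ n-1  and  -(n-j) ≤ i ≤ n-j-1   (all in ℤ).
inH : ℕ → ℤ → ℤ → Bool
inH n i j =
  ⌊ + 0 ≤? j ⌋ ∧ ⌊ j ≤? (+ n - + 1) ⌋ ∧
  ⌊ - (+ n - j) ≤? i ⌋ ∧ ⌊ i ≤? (+ n - j - + 1) ⌋

range : ℤ → ℕ → List ℤ
range a zero    = []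
range a (suc k) = a ∷ range (a + + 1) k

intRange : ℤ → ℤ → List ℤ
intRange a b = if′ ⌊ a <? b ⌋ (range a ∣ b - a ∣)
  where
  if′ : Bool → List ℤ → List ℤ
  if′ true  l = l
  if′ false _ = []

allL : {A : Set} → (A → Bool) → List A → Bool
allL p []       = true
allL p (a ∷ as) = p a ∧ allL p as

-- A lattice rectangle [x,x']×[y,y'] is encoded by (x , x' , y , y').
Rect : Set
Rect = ℤ × ℤ × ℤ × ℤ

isLatticeRect : Rect → Bool
isLatticeRect (x , x' , y , y') = ⌊ x <? x' ⌋ ∧ ⌊ y <? y' ⌋

subsetOfH : ℕ → Rect → Bool
subsetOfH n (x , x' , y , y') =
  allL (λ j → allL (λ i → inH n i j) (intRange x x')) (intRange y y')

rectInH : ℕ → Rect → Bool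
rectInH n r = isLatticeRect r ∧ subsetOfH n r

{-# OPTIONS --safe #-}
-- The rows of H_n are centred and shrink going up, so a lattice rectangle [x,x']×[y,y']
-- lies in H_n exactly when 0 ≤ y < y' ≤ n and its top row fits: -w ≤ x < x' ≤ w with
-- w = n - y' + 1.  Hence there are (k + 1)·w(2w + 1) rectangles with top edge y' = k + 1,
-- where w = n - k, and summing over k gives n(n+1)(n+2)²/6.  The binomial form follows
-- from 4!·C(m,4) = m(m-1)(m-2)(m-3).
module Submission where

open import Defs

module FiniteSums where

  open import Data.Nat using (ℕ; zero; suc; _+_; _*_)
  open import Data.Nat.Properties using (+-comm; +-assoc; *-cancelˡ-≡; +-cancelʳ-≡)
  open import Data.Nat.Tactic.RingSolver using (solve-∀)
  open import Relation.Binary.PropositionalEquality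
  open ≡-Reasoning

  ∑< : ℕ → (ℕ → ℕ) → ℕ
  ∑< zero    f = 0
  ∑< (suc n) f = f 0 + ∑< n (λ k → f (suc k))

  ∑<-cong : ∀ n {f g : ℕ → ℕ} → (∀ k → f k ≡ g k) → ∑< n f ≡ ∑< n g
  ∑<-cong zero    f≗g = refl
  ∑<-cong (suc n) f≗g = cong₂ _+_ (f≗g 0) (∑<-cong n (λ k → f≗g (suc k)))

  ∑<-+ : ∀ n (f g : ℕ → ℕ) → ∑< n (λ k → f k + g k) ≡ ∑< n f + ∑< n g
  ∑<-+ zero    f g = refl
  ∑<-+ (suc n) f g = begin
    f 0 + g 0 + ∑< n (λ k → f (suc k) + g (suc k))
      ≡⟨ cong (f 0 + g 0 +_) (∑<-+ n (λ k → f (suc k)) (λ k → g (suc k))) ⟩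
    f 0 + g 0 + (∑< n (λ k → f (suc k)) + ∑< n (λ k → g (suc k)))
      ≡⟨ interchange (f 0) (g 0) _ _ ⟩
    f 0 + ∑< n (λ k → f (suc k)) + (g 0 + ∑< n (λ k → g (suc k))) ∎
    where
    interchange : ∀ a b c d → a + b + (c + d) ≡ a + c + (b + d)
    interchange = solve-∀

  ∑<-const : ∀ n c → ∑< n (λ _ → c) ≡ n * c
  ∑<-const zero    c = refl
  ∑<-const (suc n) c = cong (c +_) (∑<-const n c)

  ∑<-last : ∀ n (f : ℕ → ℕ) → ∑< (suc n) f ≡ ∑< n f + f n
  ∑<-last zero    f = +-comm (f 0) 0
  ∑<-last (suc n) f = begin
    f 0 + ∑< (suc n) (λ k → f (suc k)) ≡⟨ cong (f 0 +_) (∑<-last n (λ k → f (suc k))) ⟩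
    f 0 + (∑< n (λ k → f (suc k)) + f (suc n)) ≡⟨ +-assoc (f 0) _ _ ⟨
    f 0 + ∑< n (λ k → f (suc k)) + f (suc n) ∎

  2*∑<id+n≡n*n : ∀ n → 2 * ∑< n (λ k → k) + n ≡ n * n
  2*∑<id+n≡n*n zero    = refl
  2*∑<id+n≡n*n (suc n) = begin
    2 * ∑< (suc n) (λ k → k) + suc n ≡⟨ cong (λ s → 2 * s + suc n) (∑<-last n (λ k → k)) ⟩
    2 * (∑< n (λ k → k) + n) + suc n ≡⟨ regroup (∑< n (λ k → k)) n ⟩
    (2 * ∑< n (λ k → k) + n) + (2 * n + 1) ≡⟨ cong (_+ (2 * n + 1)) (2*∑<id+n≡n*n n) ⟩
    n * n + (2 * n + 1) ≡⟨ square-suc n ⟩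
    suc n * suc n ∎
    where
    regroup : ∀ s n → 2 * (s + n) + (1 + n) ≡ (2 * s + n) + (2 * n + 1)
    regroup = solve-∀
    square-suc : ∀ n → n * n + (2 * n + 1) ≡ (1 + n) * (1 + n)
    square-suc = solve-∀

  ∑<id-odd : ∀ m → ∑< (suc (2 * m)) (λ k → k) ≡ m * suc (2 * m)
  ∑<id-odd m = *-cancelˡ-≡ _ _ 2 (+-cancelʳ-≡ (suc (2 * m)) _ _
    (trans (2*∑<id+n≡n*n (suc (2 * m))) (square-odd m)))
    where
    square-odd : ∀ m → (1 + 2 * m) * (1 + 2 * m) ≡ 2 * (m * (1 + 2 * m)) + (1 + 2 * m)
    square-odd = solve-∀

module ClosedForms where

  open import Data.Bool using (true; false)
  open import Data.Nat using (ℕ; zero; suc; _+_; _*_; _∸_; _^_; _≤_; _<_; s≤s; _!; _≤ᵇ_; _≤?_)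
  open import Data.Nat.Properties using (+-comm; +-assoc; *-comm; *-cancelˡ-≡; m≤n⇒m∸n≡0; ≤⇒≤ᵇ; ≰⇒>; _!≢0)
  open import Data.Nat.Combinatorics using (_C_; _P_; nCk≡nPk/k!; k>n⇒nCk≡0)
  open import Data.Nat.Combinatorics.Base using (_P′_)
  open import Data.Nat.Combinatorics.Specification using (k!∣nP′k)
  open import Data.Nat.DivMod using (_/_; m/n*n≡m; m*n/n≡m)
  open import Data.Nat.Tactic.RingSolver using (solve-∀)
  open import Relation.Nullary using (yes; no)
  open import Relation.Binary.PropositionalEquality
  open ≡-Reasoning
  open FiniteSums

  -- the number of pairs x < x' of integers in [-m, m]
  pairs : ℕ → ℕ
  pairs m = m * suc (2 * m)

  pyramid : ℕ → ℕ
  pyramid n = ∑< n (λ k → suc k * pairs (n ∸ k))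

  6*∑<pairs : ∀ n → 6 * ∑< n (λ k → pairs (n ∸ k)) ≡ n * (n + 1) * (4 * n + 5)
  6*∑<pairs zero    = refl
  6*∑<pairs (suc n) = begin
    6 * (pairs (suc n) + ∑< n (λ k → pairs (n ∸ k)))
      ≡⟨ distrib (pairs (suc n)) _ ⟩
    6 * pairs (suc n) + 6 * ∑< n (λ k → pairs (n ∸ k))
      ≡⟨ cong (6 * pairs (suc n) +_) (6*∑<pairs n) ⟩
    6 * pairs (suc n) + n * (n + 1) * (4 * n + 5)
      ≡⟨ step n ⟩
    suc n * (suc n + 1) * (4 * suc n + 5) ∎
    where
    distrib : ∀ a b → 6 * (a + b) ≡ 6 * a + 6 * b
    distrib = solve-∀
    step : ∀ n → 6 * ((1 + n) * suc (2 * (1 + n))) + n * (n + 1) * (4 * n + 5)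
               ≡ (1 + n) * ((1 + n) + 1) * (4 * (1 + n) + 5)
    step = solve-∀

  pyramid-suc : ∀ n → pyramid (suc n) ≡ pairs (suc n) + ∑< n (λ k → pairs (n ∸ k)) + pyramid n
  pyramid-suc n = begin
    pairs (suc n) + 0 + ∑< n (λ k → pairs (n ∸ k) + suc k * pairs (n ∸ k))
      ≡⟨ cong₂ _+_ (+-comm (pairs (suc n)) 0) (∑<-+ n (λ k → pairs (n ∸ k)) (λ k → suc k * pairs (n ∸ k))) ⟩
    pairs (suc n) + (∑< n (λ k → pairs (n ∸ k)) + pyramid n)
      ≡⟨ sym (+-assoc (pairs (suc n)) _ _) ⟩
    pairs (suc n) + ∑< n (λ k → pairs (n ∸ k)) + pyramid n ∎

  6*pyramid : ∀ n → 6 * pyramid n ≡ n * (n + 1) * (n + 2) ^ 2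
  6*pyramid zero    = refl
  6*pyramid (suc n) = begin
    6 * pyramid (suc n)
      ≡⟨ cong (6 *_) (pyramid-suc n) ⟩
    6 * (pairs (suc n) + ∑< n (λ k → pairs (n ∸ k)) + pyramid n)
      ≡⟨ distrib (pairs (suc n)) _ _ ⟩
    6 * pairs (suc n) + 6 * ∑< n (λ k → pairs (n ∸ k)) + 6 * pyramid n
      ≡⟨ cong₂ (λ a b → 6 * pairs (suc n) + a + b) (6*∑<pairs n) (6*pyramid n) ⟩
    6 * pairs (suc n) + n * (n + 1) * (4 * n + 5) + n * (n + 1) * (n + 2) ^ 2
      ≡⟨ step n ⟩
    suc n * (suc n + 1) * (suc n + 2) ^ 2 ∎
    where
    distrib : ∀ a b c → 6 * (a + b + c) ≡ 6 * a + 6 * b + 6 * c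
    distrib = solve-∀
    step : ∀ n → 6 * ((1 + n) * suc (2 * (1 + n))) + n * (n + 1) * (4 * n + 5)
                   + n * (n + 1) * ((n + 2) * ((n + 2) * 1))
               ≡ (1 + n) * ((1 + n) + 1) * (((1 + n) + 2) * (((1 + n) + 2) * 1))
    step = solve-∀

  nP′k≡0 : ∀ {n k} → n < k → n P′ k ≡ 0
  nP′k≡0 {n} {suc k} (s≤s n≤k) rewrite m≤n⇒m∸n≡0 n≤k = refl

  nPk≡nP′k : ∀ {n k} → k ≤ n → n P k ≡ n P′ k
  nPk≡nP′k {n} {k} k≤n with k ≤ᵇ n | ≤⇒≤ᵇ k≤n
  ... | true  | _  = refl
  ... | false | ()

  -- For n < k both sides vanish.
  nCk*k!≡nP′k : ∀ n k → (n C k) * k ! ≡ n P′ k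
  nCk*k!≡nP′k n k with k ≤? n
  ... | yes k≤n = begin
    (n C k) * k !           ≡⟨ cong (_* k !) (nCk≡nPk/k! k≤n) ⟩
    (n P k) / k ! * k !   ≡⟨ cong (λ p → p / k ! * k !) (nPk≡nP′k k≤n) ⟩
    (n P′ k) / k ! * k !  ≡⟨ m/n*n≡m (k!∣nP′k k≤n) ⟩
    n P′ k              ∎
    where instance _ = k !≢0
  ... | no k≰n = trans (cong (_* k !) (k>n⇒nCk≡0 (≰⇒> k≰n))) (sym (nP′k≡0 (≰⇒> k≰n)))

  binomials : ℕ → ℕ
  binomials n = 3 * ((n + 3) C 4) + (n + 2) C 4

  6*binomials : ∀ p → 6 * binomials (suc p) ≡ suc p * (suc p + 1) * (suc p + 2) ^ 2
  6*binomials p = *-cancelˡ-≡ _ _ 4 (begin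
    4 * (6 * binomials n)
      ≡⟨ scale ((n + 3) C 4) ((n + 2) C 4) ⟩
    3 * (((n + 3) C 4) * 4 !) + ((n + 2) C 4) * 4 !
      ≡⟨ cong₂ (λ a b → 3 * ((a C 4) * 4 !) + (b C 4) * 4 !) (+-comm n 3) (+-comm n 2) ⟩
    3 * (((3 + n) C 4) * 4 !) + ((2 + n) C 4) * 4 !
      ≡⟨ cong₂ (λ a b → 3 * a + b) (nCk*k!≡nP′k (3 + n) 4) (nCk*k!≡nP′k (2 + n) 4) ⟩
    3 * ((3 + n) P′ 4) + (2 + n) P′ 4
      ≡⟨ falling p ⟩
    4 * (n * (n + 1) * (n + 2) ^ 2) ∎)
    where
    n : ℕ
    n = suc p
    scale : ∀ a b → 4 * (6 * (3 * a + b)) ≡ 3 * (a * 24) + b * 24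
    scale = solve-∀
    falling : ∀ p → 3 * ((1 + p) * ((2 + p) * ((3 + p) * ((4 + p) * 1)))) + p * ((1 + p) * ((2 + p) * ((3 + p) * 1)))
                  ≡ 4 * ((1 + p) * ((1 + p) + 1) * (((1 + p) + 2) * (((1 + p) + 2) * 1)))
    falling = solve-∀

  binomials≡pyramid : ∀ p → binomials (suc p) ≡ pyramid (suc p)
  binomials≡pyramid p = *-cancelˡ-≡ _ _ 6 (trans (6*binomials p) (sym (6*pyramid (suc p))))

  binomials≡closedForm : ∀ p → binomials (suc p) ≡ (suc p * (suc p + 1) * (suc p + 2) ^ 2) / 6
  binomials≡closedForm p = begin
    binomials (suc p)                                   ≡⟨ m*n/n≡m (binomials (suc p)) 6 ⟨
    binomials (suc p) * 6 / 6                           ≡⟨ cong (_/ 6) (*-comm (binomials (suc p)) 6) ⟩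
    6 * binomials (suc p) / 6                           ≡⟨ cong (_/ 6) (6*binomials p) ⟩
    (suc p * (suc p + 1) * (suc p + 2) ^ 2) / 6 ∎

module Intervals where

  open import Data.Nat as ℕ using (ℕ; zero; suc)
  open import Data.Integer using (ℤ; +_; _+_; _≤_; _<_; _≟_; 1ℤ) renaming (suc to sucℤ)
  open import Data.Integer.Properties
    using (≤-refl; ≤-trans; ≤-irrelevant; <-irrelevant; <-irrefl; ≤⇒≯; ≤∧≢⇒<; i≤suc[i]; i≤i+j;
           i<j⇒suc[i]≤j; suc[i]≤j⇒i<j; +-identityʳ)
  open import Data.Integer.Tactic.RingSolver using (solve-∀)
  open import Data.Empty using (⊥-elim)
  open import Data.Fin using (Fin)
  open import Data.Fin.Properties using (+↔⊎)
  open import Data.Product using (Σ; _×_; _,_)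
  open import Data.Sum using (_⊎_; inj₁; inj₂)
  open import Data.Sum.Function.Propositional using (_⊎-↔_)
  open import Function using (_∘_)
  open import Function.Bundles using (_↔_; mk↔ₛ′)
  open import Function.Properties.Inverse using (↔-trans; ↔-sym)
  open import Relation.Nullary using (¬_; Dec; yes; no; Irrelevant)
  open import Relation.Binary.PropositionalEquality
  open FiniteSums using (∑<)

  Interval : ℤ → ℤ → (ℤ → Set) → Set
  Interval a b A = Σ ℤ λ z → (a ≤ z × z < b) × A z

  bounds-irrelevant : ∀ {a b z} → Irrelevant (a ≤ z × z < b)
  bounds-irrelevant (p , q) (p′ , q′) = cong₂ _,_ (≤-irrelevant p p′) (<-irrelevant q q′)

  module _ {a b : ℤ} {A : ℤ → Set} where

    Interval-empty : a ≡ b → Interval a b A ↔ Fin 0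
    Interval-empty refl = mk↔ₛ′ (⊥-elim ∘ absurd) (λ ()) (λ ()) (⊥-elim ∘ absurd)
      where
      absurd : ¬ Interval a a A
      absurd (z , (a≤z , z<a) , _) = ⊥-elim (≤⇒≯ a≤z z<a)

    Interval-uncons : a < b → Interval a b A ↔ (A a ⊎ Interval (sucℤ a) b A)
    Interval-uncons a<b = mk↔ₛ′ to from to∘from from∘to
      where
      split : ∀ z → Dec (z ≡ a) → a ≤ z → z < b → A z → A a ⊎ Interval (sucℤ a) b A
      split z (yes refl) _   _   x = inj₁ x
      split z (no z≢a)   a≤z z<b x = inj₂ (z , (i<j⇒suc[i]≤j (≤∧≢⇒< a≤z (z≢a ∘ sym)) , z<b) , x)

      to : Interval a b A → A a ⊎ Interval (sucℤ a) b A
      to (z , (a≤z , z<b) , x) = split z (z ≟ a) a≤z z<b x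

      from : A a ⊎ Interval (sucℤ a) b A → Interval a b A
      from (inj₁ x)                      = a , (≤-refl , a<b) , x
      from (inj₂ (z , (1+a≤z , z<b) , x)) = z , (≤-trans (i≤suc[i] a) 1+a≤z , z<b) , x

      to∘from : ∀ w → to (from w) ≡ w
      to∘from (inj₁ x) with a ≟ a
      ... | yes refl = refl
      ... | no a≢a   = ⊥-elim (a≢a refl)
      to∘from (inj₂ (z , (1+a≤z , z<b) , x)) with z ≟ a
      ... | yes refl = ⊥-elim (<-irrefl refl (suc[i]≤j⇒i<j 1+a≤z))
      ... | no _     = cong (λ p → inj₂ (z , p , x)) (bounds-irrelevant _ _)

      from-split : ∀ z d a≤z z<b x → from (split z d a≤z z<b x) ≡ (z , (a≤z , z<b) , x)
      from-split z (yes refl) _ _ x = cong (λ p → z , p , x) (bounds-irrelevant _ _)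
      from-split z (no _)     _ _ x = cong (λ p → z , p , x) (bounds-irrelevant _ _)

      from∘to : ∀ w → from (to w) ≡ w
      from∘to (z , (a≤z , z<b) , x) = from-split z (z ≟ a) a≤z z<b x

  suc[a]+N≡a+suc[N] : ∀ a N → sucℤ a + + N ≡ a + + suc N
  suc[a]+N≡a+suc[N] a N = ring a (+ N)
    where
    ring : ∀ a n → (1ℤ + a) + n ≡ a + (1ℤ + n)
    ring = solve-∀

  a<a+suc[N] : ∀ a N → a < a + + suc N
  a<a+suc[N] a N = suc[i]≤j⇒i<j (subst (sucℤ a ≤_) (suc[a]+N≡a+suc[N] a N) (i≤i+j (sucℤ a) (+ N)))

  Interval↔Fin-∑< : ∀ N {a b} {A : ℤ → Set} {g : ℕ → ℕ} → a + + N ≡ b →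
                    (∀ k → k ℕ.< N → A (a + + k) ↔ Fin (g k)) → Interval a b A ↔ Fin (∑< N g)
  Interval↔Fin-∑< zero    {a} a+0≡b _ = Interval-empty (trans (sym (+-identityʳ a)) a+0≡b)
  Interval↔Fin-∑< (suc N) {a} {A = A} refl count =
    ↔-trans (Interval-uncons (a<a+suc[N] a N))
      (↔-trans (head ⊎-↔ Interval↔Fin-∑< N (suc[a]+N≡a+suc[N] a N) tail) (↔-sym +↔⊎))
    where
    head : A a ↔ Fin _
    head = subst (λ z → A z ↔ Fin _) (+-identityʳ a) (count 0 (ℕ.s≤s ℕ.z≤n))
    tail : ∀ k → k ℕ.< N → A (sucℤ a + + k) ↔ Fin _
    tail k k<N = subst (λ z → A z ↔ Fin _) (sym (suc[a]+N≡a+suc[N] a k)) (count (suc k) (ℕ.s≤s k<N))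

module Decoding where

  open import Data.Bool using (Bool; T; _∧_)
  open import Data.Bool.Properties using (T-∧)
  open import Data.Nat as ℕ using (ℕ; zero; suc)
  open import Data.Integer using (ℤ; +_; -_; _+_; _-_; ∣_∣; _≤_; _<_; _≟_; _<?_; _≤?_)
  open import Data.Integer.Properties
    using (≤-refl; ≤-trans; <⇒≤; ≤⇒≯; ≤∧≢⇒<; ≤-<-trans; i<j⇒suc[i]≤j; i≤j⇒0≤j-i;
           +-identityʳ; +-comm; i≤i+j; 0≤i⇒+∣i∣≡i)
  open import Data.Integer.Tactic.RingSolver using (solve-∀)
  open import Data.List using ([]; _∷_)
  open import Data.List.Relation.Unary.All as All using (All; []; _∷_)
  open import Data.List.Membership.Propositional using (_∈_)
  open import Data.List.Relation.Unary.Any using (here; there)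
  open import Data.Empty using (⊥-elim)
  open import Data.Product using (_×_; _,_)
  open import Data.Unit using (tt)
  open import Function using (_∘_)
  open import Function.Bundles using (_⇔_; mk⇔; Equivalence)
  open import Data.Product.Function.NonDependent.Propositional using (_×-⇔_)
  open import Function.Properties.Equivalence using () renaming (trans to ⇔-trans)
  open import Relation.Nullary using (Dec; yes; no)
  open import Relation.Nullary.Decidable using (⌊_⌋; toWitness; fromWitness)
  open import Relation.Binary.PropositionalEquality
  open Equivalence using (to; from)
  open Intervals using (suc[a]+N≡a+suc[N]; a<a+suc[N])

  T-allL : ∀ {A : Set} (p : A → Bool) xs → T (allL p xs) ⇔ All (T ∘ p) xs
  T-allL p []       = mk⇔ (λ _ → []) (λ _ → tt)
  T-allL p (x ∷ xs) = mk⇔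
    (λ t → let px , pxs = to T-∧ t in px ∷ to (T-allL p xs) pxs)
    (λ { (px ∷ pxs) → from T-∧ (px , from (T-allL p xs) pxs) })

  ∈-range : ∀ a N {k} → k ∈ range a N ⇔ (a ≤ k × k < a + + N)
  ∈-range a N = mk⇔ (bounded a N) (member a N)
    where
    shift : ∀ a N → (a + + 1) + + N ≡ a + + suc N
    shift a N = trans (cong (_+ + N) (+-comm a (+ 1))) (suc[a]+N≡a+suc[N] a N)

    bounded : ∀ a N {k} → k ∈ range a N → a ≤ k × k < a + + N
    bounded a (suc N) (here refl) = ≤-refl , a<a+suc[N] a N
    bounded a (suc N) (there k∈) =
      let a+1≤k , k<top = bounded (a + + 1) N k∈
      in  ≤-trans (i≤i+j a (+ 1)) a+1≤k , subst (_ <_) (shift a N) k<top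

    member : ∀ a N {k} → a ≤ k × k < a + + N → k ∈ range a N
    member a zero    {k} (a≤k , k<a) = ⊥-elim (≤⇒≯ a≤k (subst (k <_) (+-identityʳ a) k<a))
    member a (suc N) {k} (a≤k , k<top) with k ≟ a
    ... | yes refl = here refl
    ... | no k≢a   = there (member (a + + 1) N
      (subst (_≤ k) (+-comm (+ 1) a) (i<j⇒suc[i]≤j (≤∧≢⇒< a≤k (k≢a ∘ sym))) ,
       subst (k <_) (sym (shift a N)) k<top))

  ∈-intRange : ∀ a b {k} → k ∈ intRange a b ⇔ (a ≤ k × k < b)
  ∈-intRange a b {k} with a <? b
  ... | yes a<b = subst (λ c → k ∈ range a ∣ b - a ∣ ⇔ (a ≤ k × k < c)) a+∣b-a∣≡b (∈-range a ∣ b - a ∣)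
    where
    ring : ∀ a b → a + (b - a) ≡ b
    ring = solve-∀
    a+∣b-a∣≡b : a + + ∣ b - a ∣ ≡ b
    a+∣b-a∣≡b = trans (cong (λ c → a + c) (0≤i⇒+∣i∣≡i (i≤j⇒0≤j-i (<⇒≤ a<b)))) (ring a b)
  ... | no a≮b  = mk⇔ (λ ()) (λ (a≤k , k<b) → ⊥-elim (a≮b (≤-<-trans a≤k k<b)))

  Cell : ℕ → ℤ → ℤ → Set
  Cell n i j = + 0 ≤ j × j ≤ + n - + 1 × - (+ n - j) ≤ i × i ≤ + n - j - + 1

  T-⌊⌋ : ∀ {P : Set} (p : Dec P) → T ⌊ p ⌋ ⇔ P
  T-⌊⌋ p = mk⇔ toWitness fromWitness

  T-⌊⌋-∧ : ∀ {P Q : Set} (p : Dec P) {b} → T b ⇔ Q → T (⌊ p ⌋ ∧ b) ⇔ (P × Q)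
  T-⌊⌋-∧ p b⇔Q = ⇔-trans (T-∧ {⌊ p ⌋}) (T-⌊⌋ p ×-⇔ b⇔Q)

  T-inH : ∀ n i j → T (inH n i j) ⇔ Cell n i j
  T-inH n i j =
    T-⌊⌋-∧ (+ 0 ≤? j) (T-⌊⌋-∧ (j ≤? + n - + 1) (T-⌊⌋-∧ (- (+ n - j) ≤? i) (T-⌊⌋ (i ≤? + n - j - + 1))))

  Contained : ℕ → Rect → Set
  Contained n (x , x' , y , y') = ∀ {i j} → x ≤ i × i < x' → y ≤ j × j < y' → Cell n i j

  T-subsetOfH : ∀ n r → T (subsetOfH n r) ⇔ Contained n r
  T-subsetOfH n (x , x' , y , y') = mk⇔ decode encode
    where
    row : ℤ → Bool
    row j = allL (λ i → inH n i j) (intRange x x')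
    decode : T (subsetOfH n (x , x' , y , y')) → Contained n (x , x' , y , y')
    decode t {i} {j} i∈ j∈ =
      let rowⱼ = All.lookup (to (T-allL row (intRange y y')) t) (from (∈-intRange y y') j∈)
      in  to (T-inH n i j) (All.lookup (to (T-allL _ (intRange x x')) rowⱼ) (from (∈-intRange x x') i∈))
    encode : Contained n (x , x' , y , y') → T (subsetOfH n (x , x' , y , y'))
    encode cells = from (T-allL row (intRange y y')) (All.tabulate λ {j} j∈ →
      from (T-allL _ (intRange x x')) (All.tabulate λ {i} i∈ →
        from (T-inH n i j) (cells (to (∈-intRange x x') i∈) (to (∈-intRange y y') j∈))))

  T-rectInH : ∀ n x x' y y' →
              T (rectInH n (x , x' , y , y')) ⇔ ((x < x' × y < y') × Contained n (x , x' , y , y'))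
  T-rectInH n x x' y y' =
    ⇔-trans (T-∧ {isLatticeRect (x , x' , y , y')})
            (T-⌊⌋-∧ (x <? x') (T-⌊⌋ (y <? y')) ×-⇔ T-subsetOfH n (x , x' , y , y'))

module Geometry where

  open import Data.Bool using (T)
  open import Data.Nat using (ℕ; suc)
  open import Data.Integer using (ℤ; +_; -_; _+_; _-_; _≤_; _<_; 0ℤ)
  open import Data.Integer.Properties
    using (≤-refl; ≤-trans; <⇒≤; i<j⇒suc[i]≤j; suc[i]≤j⇒i<j; i≤j⇒0≤j-i; +-mono-≤; +-monoʳ-≤; +-identityʳ)
  open import Data.Integer.Tactic.RingSolver using (solve-∀)
  open import Data.Product using (_×_; _,_; proj₁; proj₂)
  open import Function using (_∘_)
  open import Function.Bundles using (_⇔_; mk⇔)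
  open import Function.Properties.Equivalence using () renaming (trans to ⇔-trans)
  open import Relation.Binary.PropositionalEquality
  open Decoding using (Cell; Contained; T-rectInH)

  -- Linear inequalities are proved by writing the gap as a sum of gaps known to be
  -- nonnegative; what remains is a ring identity.
  ≤-by-gap : ∀ {i j} d → 0ℤ ≤ d → j ≡ i + d → i ≤ j
  ≤-by-gap {i} d 0≤d refl = subst (_≤ i + d) (+-identityʳ i) (+-monoʳ-≤ i 0≤d)

  <-by-gap : ∀ {i j} d → 0ℤ ≤ d → j ≡ (+ 1 + i) + d → i < j
  <-by-gap d 0≤d eq = suc[i]≤j⇒i<j (≤-by-gap d 0≤d eq)

  gap< : ∀ {i j} → i < j → 0ℤ ≤ j - (+ 1 + i)
  gap< = i≤j⇒0≤j-i ∘ i<j⇒suc[i]≤j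

  infixl 6 _⊕_
  _⊕_ : ∀ {d e} → 0ℤ ≤ d → 0ℤ ≤ e → 0ℤ ≤ d + e
  _⊕_ = +-mono-≤

  -- A rectangle with top edge y' has top row y' - 1, which spans [-w, w] for w = topHalfWidth n y'.
  topHalfWidth : ℕ → ℤ → ℤ
  topHalfWidth n y' = + n - (y' - + 1)

  CornerBounds : ℕ → Rect → Set
  CornerBounds n (x , x' , y , y') =
    (+ 1 ≤ y' × y' < + suc n) × (+ 0 ≤ y × y < y') × (- w ≤ x' × x' < w + + 1) × (- w ≤ x × x < x')
    where w = topHalfWidth n y'

  a≤b-1<b : ∀ {a b} → a < b → a ≤ b - + 1 × b - + 1 < b
  a≤b-1<b {a} {b} a<b = ≤-by-gap (b - (+ 1 + a)) (gap< a<b) (ring₁ a b) , <-by-gap 0ℤ ≤-refl (ring₂ b)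
    where
    ring₁ : ∀ a b → b - + 1 ≡ a + (b - (+ 1 + a))
    ring₁ = solve-∀
    ring₂ : ∀ b → b ≡ (+ 1 + (b - + 1)) + 0ℤ
    ring₂ = solve-∀

  Contained⇒CornerBounds : ∀ n {x x' y y'} → x < x' → y < y' →
                           Contained n (x , x' , y , y') → CornerBounds n (x , x' , y , y')
  Contained⇒CornerBounds n {x} {x'} {y} {y'} x<x' y<y' cells =
    (1≤y' , y'<n+1) , (0≤y , y<y') , (≤-trans -w≤x (<⇒≤ x<x') , x'<w+1) , (-w≤x , x<x')
    where
    bottomLeft : Cell n x y
    bottomLeft = cells (≤-refl , x<x') (≤-refl , y<y')
    topLeft : Cell n x (y' - + 1)
    topLeft = cells (≤-refl , x<x') (a≤b-1<b y<y')
    topRight : Cell n (x' - + 1) (y' - + 1)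
    topRight = cells (a≤b-1<b x<x') (a≤b-1<b y<y')
    0≤y : + 0 ≤ y
    0≤y = proj₁ bottomLeft
    -w≤x : - topHalfWidth n y' ≤ x
    -w≤x = proj₁ (proj₂ (proj₂ topLeft))
    1≤y' : + 1 ≤ y'
    1≤y' = ≤-by-gap (y + (y' - (+ 1 + y))) (0≤y ⊕ gap< y<y') (ring y y')
      where
      ring : ∀ y y' → y' ≡ + 1 + (y + (y' - (+ 1 + y)))
      ring = solve-∀
    y'<n+1 : y' < + suc n
    y'<n+1 = <-by-gap _ (i≤j⇒0≤j-i (proj₁ (proj₂ topLeft))) (ring (+ n) y')
      where
      ring : ∀ n y' → + 1 + n ≡ (+ 1 + y') + ((n - + 1) - (y' - + 1))
      ring = solve-∀
    x'<w+1 : x' < topHalfWidth n y' + + 1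
    x'<w+1 = <-by-gap _ (i≤j⇒0≤j-i (proj₂ (proj₂ (proj₂ topRight)))) (ring (+ n) x' y')
      where
      ring : ∀ n x' y' → n - (y' - + 1) + + 1 ≡ (+ 1 + x') + ((n - (y' - + 1) - + 1) - (x' - + 1))
      ring = solve-∀

  CornerBounds⇒Contained : ∀ n r → CornerBounds n r → Contained n r
  CornerBounds⇒Contained n (x , x' , y , y') ((_ , y'<n+1) , (0≤y , _) , (_ , x'<w+1) , (-w≤x , _))
                         {i} {j} (x≤i , i<x') (y≤j , j<y') =
    ≤-trans 0≤y y≤j ,
    ≤-by-gap _ (gap< j<y' ⊕ gap< y'<n+1) (ring₁ (+ n) y' j) ,
    ≤-by-gap _ (i≤j⇒0≤j-i x≤i ⊕ i≤j⇒0≤j-i -w≤x ⊕ gap< j<y') (ring₂ (+ n) x y' i j) ,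
    ≤-by-gap _ (gap< x'<w+1 ⊕ gap< i<x' ⊕ gap< j<y') (ring₃ (+ n) x' y' i j)
    where
    ring₁ : ∀ n y' j → n - + 1 ≡ j + ((y' - (+ 1 + j)) + ((+ 1 + n) - (+ 1 + y')))
    ring₁ = solve-∀
    ring₂ : ∀ n x y' i j → i ≡ - (n - j) + ((i - x) + (x - - (n - (y' - + 1))) + (y' - (+ 1 + j)))
    ring₂ = solve-∀
    ring₃ : ∀ n x' y' i j → n - j - + 1 ≡ i + (((n - (y' - + 1) + + 1) - (+ 1 + x')) + (x' - (+ 1 + i)) + (y' - (+ 1 + j)))
    ring₃ = solve-∀

  T-rectInH⇔CornerBounds : ∀ n r → T (rectInH n r) ⇔ CornerBounds n r
  T-rectInH⇔CornerBounds n r@(x , x' , y , y') = ⇔-trans (T-rectInH n x x' y y') (mk⇔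
    (λ ((x<x' , y<y') , cells) → Contained⇒CornerBounds n x<x' y<y' cells)
    (λ bounds@(_ , (_ , y<y') , _ , (_ , x<x')) → (x<x' , y<y') , CornerBounds⇒Contained n r bounds))

module Counting where

  open import Data.Bool using (T)
  open import Data.Bool.Properties using (T-irrelevant)
  open import Data.Nat as ℕ using (ℕ; suc; _∸_)
  open import Data.Nat.Properties using (m∸n+n≡m; *-identityʳ; <⇒≤)
  open import Data.Integer using (+_; -_; _+_; _-_; _*_)
  open import Data.Integer.Properties using (pos-*)
  open import Data.Integer.Tactic.RingSolver using (solve-∀)
  open import Data.Fin using (Fin)
  open import Data.Fin.Properties using (1↔⊤)
  open import Data.Product using (Σ; _×_; _,_)
  open import Data.Product.Function.Dependent.Propositional using (Σ-↔)
  open import Data.Unit using (⊤; tt)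
  open import Function using (_∘_)
  open import Function.Bundles using (_↔_; _⇔_; mk↔ₛ′; Equivalence)
  open import Function.Properties.Inverse using (↔-refl; ↔-sym; ↔-trans)
  open import Relation.Nullary using (Irrelevant)
  open import Relation.Binary.PropositionalEquality
  open FiniteSums
  open ClosedForms using (pyramid; pairs)
  open Intervals
  open Geometry using (CornerBounds; topHalfWidth; T-rectInH⇔CornerBounds)

  ×-irrelevant : ∀ {A B : Set} → Irrelevant A → Irrelevant B → Irrelevant (A × B)
  ×-irrelevant irrA irrB (a , b) (a′ , b′) = cong₂ _,_ (irrA a a′) (irrB b b′)

  CornerBounds-irrelevant : ∀ n r → Irrelevant (CornerBounds n r)
  CornerBounds-irrelevant n (x , x' , y , y') =
    ×-irrelevant bounds-irrelevant (×-irrelevant bounds-irrelevant (×-irrelevant bounds-irrelevant bounds-irrelevant))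

  irrelevant-⇔⇒↔ : ∀ {A B : Set} → Irrelevant A → Irrelevant B → A ⇔ B → A ↔ B
  irrelevant-⇔⇒↔ irrA irrB A⇔B = mk↔ₛ′ (to A⇔B) (from A⇔B) (λ _ → irrB _ _) (λ _ → irrA _ _)
    where open Equivalence

  RectIndex : ℕ → Set
  RectIndex n =
    Interval (+ 1) (+ suc n) λ y' → Interval (+ 0) y' λ _ →
      Interval (- topHalfWidth n y') (topHalfWidth n y' + + 1) λ x' → Interval (- topHalfWidth n y') x' λ _ → ⊤

  rectangles↔RectIndex : ∀ n → Σ Rect (T ∘ rectInH n) ↔ RectIndex n
  rectangles↔RectIndex n = ↔-trans
    (Σ-↔ ↔-refl (λ {r} → irrelevant-⇔⇒↔ T-irrelevant (CornerBounds-irrelevant n r) (T-rectInH⇔CornerBounds n r)))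
    (mk↔ₛ′ reassociate unreassociate (λ _ → refl) (λ _ → refl))
    where
    reassociate : Σ Rect (CornerBounds n) → RectIndex n
    reassociate ((x , x' , y , y') , y'∈ , y∈ , x'∈ , x∈) = y' , y'∈ , y , y∈ , x' , x'∈ , x , x∈ , tt
    unreassociate : RectIndex n → Σ Rect (CornerBounds n)
    unreassociate (y' , y'∈ , y , y∈ , x' , x'∈ , x , x∈ , tt) = (x , x' , y , y') , y'∈ , y∈ , x'∈ , x∈

  indexCount : ℕ → ℕ
  indexCount n = ∑< n λ k → ∑< (suc k) λ _ → ∑< (suc (2 ℕ.* (n ∸ k))) λ l → ∑< l λ _ → 1

  topHalfWidth-index : ∀ {n k} → k ℕ.< n → topHalfWidth n (+ 1 + + k) ≡ + (n ∸ k)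
  topHalfWidth-index {n} {k} k<n = begin
    + n - (+ 1 + + k - + 1)             ≡⟨ cong (λ m → + m - (+ 1 + + k - + 1)) (m∸n+n≡m (<⇒≤ k<n)) ⟨
    + (n ∸ k) + + k - (+ 1 + + k - + 1) ≡⟨ ring (+ (n ∸ k)) (+ k) ⟩
    + (n ∸ k)                           ∎
    where
    open ≡-Reasoning
    ring : ∀ d k → d + k - (+ 1 + k - + 1) ≡ d
    ring = solve-∀

  -w+[1+2m]≡w+1 : ∀ {w} m → w ≡ + m → - w + + suc (2 ℕ.* m) ≡ w + + 1
  -w+[1+2m]≡w+1 m refl = trans (cong (λ t → - + m + (+ 1 + t)) (pos-* 2 m)) (ring (+ m))
    where
    ring : ∀ m → - m + (+ 1 + + 2 * m) ≡ m + + 1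
    ring = solve-∀

  RectIndex↔Fin : ∀ n → RectIndex n ↔ Fin (indexCount n)
  RectIndex↔Fin n = Interval↔Fin-∑< n refl λ k k<n →
    Interval↔Fin-∑< (suc k) refl λ _ _ →
      Interval↔Fin-∑< (suc (2 ℕ.* (n ∸ k))) (-w+[1+2m]≡w+1 (n ∸ k) (topHalfWidth-index k<n)) λ l _ →
        Interval↔Fin-∑< l refl λ _ _ → ↔-sym 1↔⊤

  indexCount≡pyramid : ∀ n → indexCount n ≡ pyramid n
  indexCount≡pyramid n = ∑<-cong n λ k →
    trans (∑<-cong (suc k) λ _ → trans (∑<-cong (suc (2 ℕ.* (n ∸ k))) λ l → trans (∑<-const l 1) (*-identityʳ l))
                                       (∑<id-odd (n ∸ k)))
          (∑<-const (suc k) (pairs (n ∸ k)))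

open import Data.Bool using (T)
open import Data.Nat using (ℕ; zero; suc; _+_; _*_; _^_; _≤_)
open import Data.Nat.Combinatorics using (_C_)
open import Data.Nat.DivMod using (_/_)
open import Data.Fin using (Fin)
open import Data.Product using (Σ; _×_; _,_)
open import Function.Bundles using (_↔_)
open import Function.Properties.Inverse using (↔-trans)
open import Relation.Binary.PropositionalEquality using (_≡_; subst; trans; sym)
open ClosedForms using (binomials; binomials≡pyramid; binomials≡closedForm)
open Counting using (rectangles↔RectIndex; RectIndex↔Fin; indexCount; indexCount≡pyramid)

mainTheorem2 : (n : ℕ) → 1 ≤ n →
    (Σ Rect (λ r → T (rectInH n r)) ↔ Fin (3 * ((n + 3) C 4) + (n + 2) C 4))
    × (3 * ((n + 3) C 4) + (n + 2) C 4 ≡ (n * (n + 1) * (n + 2) ^ 2) / 6)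
mainTheorem2 zero    ()
mainTheorem2 (suc p) _ =
  subst (λ c → Σ Rect (λ r → T (rectInH (suc p) r)) ↔ Fin c) count≡binomials
        (↔-trans (rectangles↔RectIndex (suc p)) (RectIndex↔Fin (suc p))) ,
  binomials≡closedForm p
  where
  count≡binomials : indexCount (suc p) ≡ binomials (suc p)
  count≡binomials = trans (indexCount≡pyramid (suc p)) (sym (binomials≡pyramid p))
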